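{- Let $m,n$ be positive integers with $\gcd(m,n)=1$ and put $l=\gcd(m-1,n)$. Let $D,E,F\in\mathbb{Z}$ and suppose that $$P(x,y)=\frac{n}{2}\Big(x-\frac{m-1}{n}y\Big)^2+\Big(D-\frac n2\Big)x+\Big(E-\frac{(m-1)^2}{2n}\Big)y+F$$ is a quadratic packing polynomial on $I(n/m)$. Define $$k:=\Big(D-\frac n2\Big)\frac{m-1}{l}+\Big(E-\frac{(m-1)^2}{2n}\Big)\frac{n}{l},$$ and suppose $k>0$. Then $y_k=\frac{n}{l}-1$.
   Context: For $\alpha>0$, $I(\alpha)=\{(x,y)\in\mathbb{Z}^2: 0\le y\le \alpha x\}$. A quadratic packing polynomial (QPP) on a countable set $I\subset\mathbb{R}^2$ is a real polynomial of degree $2$ whose restriction to $I$ is a bijection from $I$ onto $\mathbb{N}_0=\{0,1,2,\dots\}$. For $i\in\mathbb{N}_0$, $y_i$ denotes the unique integer in $\{0,1,\dots,n/l-1\}$ satisfying $\frac{m-1}{l}\,y_i\equiv -i \pmod{n/l}$. -}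

module Defs where

open import Data.Nat as ℕ using (ℕ; NonZero; _∸_; ≢-nonZero)
open import Data.Nat.GCD using (gcd; gcd[m,n]≢0)
open import Data.Integer as ℤ using (ℤ; +_; 0ℤ; 1ℤ)
open import Data.Integer.Divisibility using (_∣_)
open import Data.Rational as ℚ using (ℚ; _/_; ½)
open import Data.Product using (_×_; Σ; ∃-syntax; _,_)
open import Data.Sum using (inj₂)
open import Relation.Binary.PropositionalEquality using (_≡_)

toℚ : ℤ → ℚ
toℚ z = z / 1

I : ℚ → ℤ → ℤ → Set
I α x y = (0ℤ ℤ.≤ y) × (toℚ y ℚ.≤ α ℚ.* toℚ x)

IsPackingOn : (ℤ → ℤ → Set) → (ℤ → ℤ → ℚ) → Set
IsPackingOn J P =
  ((x y : ℤ) → J x y → ∃[ N ] (P x y ≡ toℚ (+ N)))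
  × ((x y x' y' : ℤ) → J x y → J x' y' → P x y ≡ P x' y' → (x ≡ x') × (y ≡ y'))
  × ((N : ℕ) → ∃[ x ] ∃[ y ] (J x y × (P x y ≡ toℚ (+ N))))

lg : ℕ → ℕ → ℕ
lg m n = gcd (m ∸ 1) n

lg≢0 : ∀ m n .{{_ : NonZero n}} → NonZero (lg m n)
lg≢0 m n@(ℕ.suc _) = ≢-nonZero (gcd[m,n]≢0 (m ∸ 1) n (inj₂ (λ ())))

m-1 : ℕ → ℤ
m-1 m = + (m ∸ 1)

Ppoly : (m n : ℕ) .{{_ : NonZero n}} → (D E F : ℤ) → ℤ → ℤ → ℚ
Ppoly m n D E F x y =
    (+ n / 2) ℚ.* (u ℚ.* u)
  ℚ.+ (toℚ D ℚ.- (+ n / 2)) ℚ.* toℚ x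
  ℚ.+ (toℚ E ℚ.- ½ ℚ.* ((m-1 m ℤ.* m-1 m) / n)) ℚ.* toℚ y
  ℚ.+ toℚ F
  where
  u : ℚ
  u = toℚ x ℚ.- (m-1 m / n) ℚ.* toℚ y

kval : (m n : ℕ) .{{_ : NonZero n}} → (D E : ℤ) → ℚ
kval m n D E =
    (toℚ D ℚ.- (+ n / 2)) ℚ.* (_/_ (m-1 m) (lg m n) {{lg≢0 m n}})
  ℚ.+ (toℚ E ℚ.- ½ ℚ.* ((m-1 m ℤ.* m-1 m) / n)) ℚ.* (_/_ (+ n) (lg m n) {{lg≢0 m n}})

-- integer quotients (m-1)/l and n/l (exact, since l divides both)
a/l : (m n : ℕ) .{{_ : NonZero n}} → ℕ
a/l m n = ℕ._/_ (m ∸ 1) (lg m n) {{lg≢0 m n}}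

n/l : (m n : ℕ) .{{_ : NonZero n}} → ℕ
n/l m n = ℕ._/_ n (lg m n) {{lg≢0 m n}}

-- "y is y_i": y ∈ {0,…,n/l-1} and ((m-1)/l) y ≡ -i (mod n/l)
IsY : (m n : ℕ) .{{_ : NonZero n}} → (i y : ℕ) → Set
IsY m n i y =
  (y ℕ.< n/l m n) × ((+ n/l m n) ∣ ((+ a/l m n ℤ.* + y) ℤ.- (ℤ.- (+ i))))

-- Write m − 1 = A l and n = N l. In the coordinates t = N x − A y and y, the polynomial 2N·P
-- becomes V = l t² + α t + 2k y + 2N F with α = 2D − n, and I(n/m) becomes the cone y ≥ 0,
-- z = n x − m y ≥ 0, so V/2N is a bijection from the cone onto ℕ. Translation by (A, N) fixes t
-- and adds 2Nk to V. In a row 0 ≤ y′ < N take a far point (X, y′) with T = t(X, y′) huge: the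
-- point (x, y) on which V takes the value V(X, y′) − 2Nk cannot have its translate in the cone
-- (it would collide with (X, y′)), so 0 ≤ z(x, y) < N. Equating the two values gives
--   (t − (T − k)) (l (t + T − k) + α + 2kl) = k (lk + α + 2(z + y′ − N)),
-- whose right side is bounded independently of T, hence t = T − k and lk + α = 2(N − y′ − z).
-- The rows y′ = 0 and y′ = N − 1 force lk + α = 2, so z = N − 1 − y′, and t = T − k read
-- modulo N in these two rows gives N ∣ k − A, i.e. A (N − 1) ≡ −k (mod N).

module Submission where

open import Defs
open import Data.Nat as ℕ using (ℕ; NonZero; _∸_)
open import Data.Nat.Coprimality using (Coprime)
open import Data.Integer as ℤ using (ℤ; +_; -[1+_]; 0ℤ; 1ℤ; ∣_∣; +≤+; +<+; -≤-)
open import Data.Rational as ℚ using (ℚ; _/_; 0ℚ; toℚᵘ)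
open import Relation.Binary.PropositionalEquality

open import Data.Nat.Base using (suc; z≤n; s≤s)
import Data.Nat.Properties as ℕP
open import Data.Nat.DivMod using (m/n*n≡m)
open import Data.Nat.GCD using (gcd[m,n]∣m; gcd[m,n]∣n)
import Data.Integer.Properties as ℤP
open import Data.Integer.Divisibility.Signed
  using (_∣_; divides; ∣⇒∣ᵤ; ∣-refl; ∣m⇒∣m*n; ∣n⇒∣m*n; ∣m∣n⇒∣m+n; ∣m∣n⇒∣m-n)
open import Data.Integer.Tactic.RingSolver using (solve-∀)
import Data.Rational.Properties as ℚP
open import Data.Rational.Unnormalised as ℚᵘ using (mkℚᵘ; *≡*; *≤*) renaming (_≃_ to _≃ᵘ_)
import Data.Rational.Unnormalised.Properties as ℚᵘP
open import Data.Product using (_×_; _,_; proj₁; proj₂; ∃-syntax; map₂)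
import Data.Product as Product
open import Function using (_⇔_; mk⇔; Equivalence)
open import Relation.Nullary using (¬_)
open import Relation.Nullary.Decidable using (dec⇒maybe)
import Tactic.RingSolver as RingSolver
open import Tactic.RingSolver.Core.AlmostCommutativeRing using (AlmostCommutativeRing; fromCommutativeRing)

record IsScaledPacking (J : ℤ → ℤ → Set) (c : ℤ) (V : ℤ → ℤ → ℤ) : Set where
  field
    integral   : ∀ {x y} → J x y → ∃[ v ] V x y ≡ c ℤ.* + v
    injective  : ∀ {x y x′ y′} → J x y → J x′ y′ → V x y ≡ V x′ y′ → x ≡ x′ × y ≡ y′
    surjective : ∀ v → ∃[ x ] ∃[ y ] J x y × V x y ≡ c ℤ.* + v

module _ where
  open import Data.Rational using (_+_; _-_; _*_; _≤_)

  ℚ-ring : AlmostCommutativeRing _ _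
  ℚ-ring = fromCommutativeRing ℚP.+-*-commutativeRing (λ q → dec⇒maybe (0ℚ ℚ.≟ q))

  toℚᵘ-/ : ∀ i d → toℚᵘ (i / suc d) ≃ᵘ mkℚᵘ i d
  toℚᵘ-/ i d = ℚP.toℚᵘ-fromℚᵘ (mkℚᵘ i d)

  toℚ-injective : ∀ {i j} → toℚ i ≡ toℚ j → i ≡ j
  toℚ-injective {i} {j} eq
    with ℚᵘP.≃-trans (ℚᵘP.≃-sym (toℚᵘ-/ i 0)) (ℚᵘP.≃-trans (ℚP.toℚᵘ-cong eq) (toℚᵘ-/ j 0))
  ... | *≡* i*1≡j*1 = ℤP.*-cancelʳ-≡ i j (+ 1) i*1≡j*1

  toℚ-+ : ∀ i j → toℚ (i ℤ.+ j) ≡ toℚ i + toℚ j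
  toℚ-+ i j = ℚP.toℚᵘ-injective (begin
    toℚᵘ (toℚ (i ℤ.+ j))             ≈⟨ toℚᵘ-/ (i ℤ.+ j) 0 ⟩
    mkℚᵘ (i ℤ.+ j) 0                 ≈⟨ *≡* (identity i j) ⟩
    mkℚᵘ i 0 ℚᵘ.+ mkℚᵘ j 0           ≈⟨ ℚᵘP.+-cong (toℚᵘ-/ i 0) (toℚᵘ-/ j 0) ⟨
    toℚᵘ (toℚ i) ℚᵘ.+ toℚᵘ (toℚ j)   ≈⟨ ℚP.toℚᵘ-homo-+ (toℚ i) (toℚ j) ⟨
    toℚᵘ (toℚ i + toℚ j)             ∎)
    where
    open ℚᵘP.≃-Reasoning
    identity : ∀ i j → (i ℤ.+ j) ℤ.* (+ 1 ℤ.* + 1) ≡ (i ℤ.* + 1 ℤ.+ j ℤ.* + 1) ℤ.* + 1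
    identity = solve-∀

  toℚ-* : ∀ i j → toℚ (i ℤ.* j) ≡ toℚ i * toℚ j
  toℚ-* i j = ℚP.toℚᵘ-injective (begin
    toℚᵘ (toℚ (i ℤ.* j))             ≈⟨ toℚᵘ-/ (i ℤ.* j) 0 ⟩
    mkℚᵘ (i ℤ.* j) 0                 ≈⟨ *≡* (identity i j) ⟩
    mkℚᵘ i 0 ℚᵘ.* mkℚᵘ j 0           ≈⟨ ℚᵘP.*-cong (toℚᵘ-/ i 0) (toℚᵘ-/ j 0) ⟨
    toℚᵘ (toℚ i) ℚᵘ.* toℚᵘ (toℚ j)   ≈⟨ ℚP.toℚᵘ-homo-* (toℚ i) (toℚ j) ⟨
    toℚᵘ (toℚ i * toℚ j)             ∎)
    where
    open ℚᵘP.≃-Reasoning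
    identity : ∀ i j → i ℤ.* j ℤ.* (+ 1 ℤ.* + 1) ≡ i ℤ.* j ℤ.* + 1
    identity = solve-∀

  toℚ-neg : ∀ i → toℚ (ℤ.- i) ≡ ℚ.- toℚ i
  toℚ-neg i = ℚP.toℚᵘ-injective (begin
    toℚᵘ (toℚ (ℤ.- i))   ≈⟨ toℚᵘ-/ (ℤ.- i) 0 ⟩
    ℚᵘ.- mkℚᵘ i 0        ≈⟨ ℚᵘP.-‿cong (toℚᵘ-/ i 0) ⟨
    ℚᵘ.- toℚᵘ (toℚ i)    ≈⟨ ℚP.toℚᵘ-homo‿- (toℚ i) ⟨
    toℚᵘ (ℚ.- toℚ i)     ∎)
    where open ℚᵘP.≃-Reasoning

  toℚ-- : ∀ i j → toℚ (i ℤ.- j) ≡ toℚ i - toℚ j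
  toℚ-- i j = trans (toℚ-+ i (ℤ.- j)) (cong (_+_ (toℚ i)) (toℚ-neg j))

  toℚ-2* : ∀ i → toℚ (+ 2 ℤ.* i) ≡ toℚ i + toℚ i
  toℚ-2* i = trans (toℚ-* (+ 2) i) (identity (toℚ i))
    where
    identity : ∀ q → toℚ (+ 2) * q ≡ q + q
    identity = RingSolver.solve-∀ ℚ-ring

  /-*-toℚ : ∀ i d e j .{{_ : NonZero d}} → i ℤ.* + e ≡ j ℤ.* + d → (i / d) * toℚ (+ e) ≡ toℚ j
  /-*-toℚ i (suc d) e j eq = ℚP.toℚᵘ-injective (begin
    toℚᵘ ((i / suc d) * toℚ (+ e))            ≈⟨ ℚP.toℚᵘ-homo-* (i / suc d) (toℚ (+ e)) ⟩
    toℚᵘ (i / suc d) ℚᵘ.* toℚᵘ (toℚ (+ e))   ≈⟨ ℚᵘP.*-cong (toℚᵘ-/ i d) (toℚᵘ-/ (+ e) 0) ⟩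
    mkℚᵘ i d ℚᵘ.* mkℚᵘ (+ e) 0               ≈⟨ *≡* cross ⟩
    mkℚᵘ j 0                                  ≈⟨ toℚᵘ-/ j 0 ⟨
    toℚᵘ (toℚ j)                              ∎)
    where
    open ℚᵘP.≃-Reasoning
    cross : i ℤ.* + e ℤ.* + 1 ≡ j ℤ.* + (suc d ℕ.* 1)
    cross = trans (ℤP.*-identityʳ (i ℤ.* + e))
      (trans eq (cong (λ d′ → j ℤ.* + d′) (sym (ℕP.*-identityʳ (suc d)))))

  /-≡-toℚ : ∀ i d j .{{_ : NonZero d}} → i ≡ j ℤ.* + d → i / d ≡ toℚ j
  /-≡-toℚ i d j eq = trans (sym (ℚP.*-identityʳ (i / d))) (/-*-toℚ i d 1 j (trans (ℤP.*-identityʳ i) eq))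

  toℚ-≤-/-⇔ : ∀ m n x y .{{_ : NonZero m}} → toℚ y ≤ (+ n / m) * toℚ x ⇔ + m ℤ.* y ℤ.≤ + n ℤ.* x
  toℚ-≤-/-⇔ (suc m) n x y = mk⇔ to from
    where
    y≃ : toℚᵘ (toℚ y) ≃ᵘ mkℚᵘ y 0
    y≃ = toℚᵘ-/ y 0
    nx/m≃ : toℚᵘ ((+ n / suc m) * toℚ x) ≃ᵘ mkℚᵘ (+ n) m ℚᵘ.* mkℚᵘ x 0
    nx/m≃ = ℚᵘP.≃-trans (ℚP.toℚᵘ-homo-* (+ n / suc m) (toℚ x))
      (ℚᵘP.*-cong (toℚᵘ-/ (+ n) m) (toℚᵘ-/ x 0))
    y*m≡m*y : y ℤ.* + (suc m ℕ.* 1) ≡ + suc m ℤ.* y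
    y*m≡m*y = trans (cong (λ d → y ℤ.* + d) (ℕP.*-identityʳ (suc m))) (ℤP.*-comm y (+ suc m))
    to : toℚ y ≤ (+ n / suc m) * toℚ x → + suc m ℤ.* y ℤ.≤ + n ℤ.* x
    to le with ℚᵘP.≤-respʳ-≃ nx/m≃ (ℚᵘP.≤-respˡ-≃ y≃ (ℚP.toℚᵘ-mono-≤ le))
    ... | *≤* y*m≤nx*1 = subst₂ ℤ._≤_ y*m≡m*y (ℤP.*-identityʳ (+ n ℤ.* x)) y*m≤nx*1
    from : + suc m ℤ.* y ℤ.≤ + n ℤ.* x → toℚ y ≤ (+ n / suc m) * toℚ x
    from le = ℚP.toℚᵘ-cancel-≤ (ℚᵘP.≤-respʳ-≃ (ℚᵘP.≃-sym nx/m≃) (ℚᵘP.≤-respˡ-≃ (ℚᵘP.≃-sym y≃)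
      (*≤* (subst₂ ℤ._≤_ (sym y*m≡m*y) (sym (ℤP.*-identityʳ (+ n ℤ.* x))) le))))

  P-expansion : ∀ (X Y D E F N A l h r w K : ℚ) →
    h + h ≡ l * N → r * N ≡ A → (D - h) * A + (E - w) * N ≡ K →
    (N + N) * (h * ((X - r * Y) * (X - r * Y)) + (D - h) * X + (E - w) * Y + F)
    ≡ l * ((N * X - A * Y) * (N * X - A * Y)) + (D + D - l * N) * (N * X - A * Y) + (K + K) * Y + (N + N) * F
  P-expansion X Y D E F N A l h r w K h+h≡lN rN≡A K≡ = begin
    (N + N) * (h * ((X - r * Y) * (X - r * Y)) + (D - h) * X + (E - w) * Y + F)
      ≡⟨ expand X Y D E F N A l h r w ⟩
    G (h + h) (r * N) K′
      ≡⟨ cong₂ (λ a b → G a b K′) h+h≡lN rN≡A ⟩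
    G (l * N) A K′
      ≡⟨ cong (G (l * N) A) K≡ ⟩
    G (l * N) A K
      ≡⟨ collapse X Y D F N A l r K ⟩
    l * ((N * X - A * Y) * (N * X - A * Y)) + (D + D - l * N) * (N * X - A * Y) + (K + K) * Y + (N + N) * F ∎
    where
    open ≡-Reasoning
    K′ : ℚ
    K′ = (D - h) * A + (E - w) * N
    G : ℚ → ℚ → ℚ → ℚ
    G a b κ = l * ((N * X - A * Y) * (N * X - A * Y)) + (D + D - l * N) * (N * X - A * Y)
              + (κ + κ) * Y + (N + N) * F
            + (a - l * N) * (N * ((X - r * Y) * (X - r * Y)) - N * X + A * Y)
            + (b - A) * (l * Y * ((r * N - A) * Y - (N * X - A * Y) - (N * X - A * Y)))
    expand : ∀ X Y D E F N A l h r w →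
      (N + N) * (h * ((X - r * Y) * (X - r * Y)) + (D - h) * X + (E - w) * Y + F)
      ≡ l * ((N * X - A * Y) * (N * X - A * Y)) + (D + D - l * N) * (N * X - A * Y)
          + (((D - h) * A + (E - w) * N) + ((D - h) * A + (E - w) * N)) * Y + (N + N) * F
        + (h + h - l * N) * (N * ((X - r * Y) * (X - r * Y)) - N * X + A * Y)
        + (r * N - A) * (l * Y * ((r * N - A) * Y - (N * X - A * Y) - (N * X - A * Y)))
    expand = RingSolver.solve-∀ ℚ-ring
    collapse : ∀ X Y D F N A l r K →
      l * ((N * X - A * Y) * (N * X - A * Y)) + (D + D - l * N) * (N * X - A * Y) + (K + K) * Y + (N + N) * F
        + (l * N - l * N) * (N * ((X - r * Y) * (X - r * Y)) - N * X + A * Y)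
        + (A - A) * (l * Y * ((r * N - A) * Y - (N * X - A * Y) - (N * X - A * Y)))
      ≡ l * ((N * X - A * Y) * (N * X - A * Y)) + (D + D - l * N) * (N * X - A * Y) + (K + K) * Y + (N + N) * F
    collapse = RingSolver.solve-∀ ℚ-ring

  IsPackingOn⇒IsScaledPacking : ∀ {J K : ℤ → ℤ → Set} {P : ℤ → ℤ → ℚ} {V : ℤ → ℤ → ℤ}
    (c : ℤ) .{{_ : ℤ.NonZero c}} → (∀ {x y} → J x y → K x y) → (∀ {x y} → K x y → J x y) →
    (∀ x y → toℚ c * P x y ≡ toℚ (V x y)) → IsPackingOn J P → IsScaledPacking K c V
  IsPackingOn⇒IsScaledPacking {J} {K} {P} {V} c J⇒K K⇒J cP≡V (integral , injective , surjective) = record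
    { integral   = λ k∈ → map₂ V≡c*v (integral _ _ (K⇒J k∈))
    ; injective  = injective′
    ; surjective = λ v → map₂ (map₂ (Product.map J⇒K V≡c*v)) (surjective v)
    }
    where
    V≡c*v : ∀ {x y v} → P x y ≡ toℚ (+ v) → V x y ≡ c ℤ.* + v
    V≡c*v {x} {y} {v} P≡v = toℚ-injective (begin
      toℚ (V x y)          ≡⟨ cP≡V x y ⟨
      toℚ c * P x y        ≡⟨ cong (toℚ c *_) P≡v ⟩
      toℚ c * toℚ (+ v)    ≡⟨ toℚ-* c (+ v) ⟨
      toℚ (c ℤ.* + v)      ∎)
      where open ≡-Reasoning
    injective′ : ∀ {x y x′ y′} → K x y → K x′ y′ → V x y ≡ V x′ y′ → x ≡ x′ × y ≡ y′
    injective′ {x} {y} {x′} {y′} k∈ k∈′ V≡V′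
      with integral _ _ (K⇒J k∈) | integral _ _ (K⇒J k∈′)
    ... | v , P≡v | v′ , P′≡v′ = injective _ _ _ _ (K⇒J k∈) (K⇒J k∈′) (begin
      P x y          ≡⟨ P≡v ⟩
      toℚ (+ v)      ≡⟨ cong toℚ (ℤP.*-cancelˡ-≡ c (+ v) (+ v′) cv≡cv′) ⟩
      toℚ (+ v′)     ≡⟨ P′≡v′ ⟨
      P x′ y′        ∎)
      where
      open ≡-Reasoning
      cv≡cv′ : c ℤ.* + v ≡ c ℤ.* + v′
      cv≡cv′ = trans (sym (V≡c*v P≡v)) (trans V≡V′ (V≡c*v P′≡v′))

open import Data.Integer using (_+_; _*_; _-_; -_; _≤_; _<_)

*-nonNeg : ∀ {i j} → 0ℤ ≤ i → 0ℤ ≤ j → 0ℤ ≤ i * j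
*-nonNeg (+≤+ {n = a} _) (+≤+ {n = b} _) = subst (0ℤ ≤_) (ℤP.pos-* a b) (+≤+ z≤n)

0≤+ : ∀ n → 0ℤ ≤ + n
0≤+ n = +≤+ z≤n

0≤i+∣i∣ : ∀ i → 0ℤ ≤ i + + ∣ i ∣
0≤i+∣i∣ (+ n)    = ℤP.+-mono-≤ (0≤+ n) (0≤+ n)
0≤i+∣i∣ -[1+ n ] = ℤP.≤-reflexive (sym (ℤP.+-inverseˡ (+ suc n)))

≤-by-gap : ∀ {i j} d → 0ℤ ≤ d → j ≡ i + d → i ≤ j
≤-by-gap {i} d 0≤d refl = ℤP.≤-trans (ℤP.≤-reflexive (sym (ℤP.+-identityʳ i))) (ℤP.+-monoʳ-≤ i 0≤d)

≤-by-gap-and-zero : ∀ {i j} d e → 0ℤ ≤ d → e ≡ 0ℤ → j ≡ i + d + e → i ≤ j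
≤-by-gap-and-zero {i} d _ 0≤d refl eq = ≤-by-gap d 0≤d (trans eq (ℤP.+-identityʳ (i + d)))

∣i∣≤n : ∀ {i n} → - + n ≤ i → i ≤ + n → ∣ i ∣ ℕ.≤ n
∣i∣≤n {+ _}               _         (+≤+ i≤n) = i≤n
∣i∣≤n { -[1+ _ ]} {suc _} (-≤- i<n) _         = s≤s i<n

i*j≡k∧∣k∣<j⇒i≡0 : ∀ i j k → i * j ≡ k → + ∣ k ∣ < j → i ≡ 0ℤ
i*j≡k∧∣k∣<j⇒i≡0 i (+ j) _ refl (+<+ ∣ij∣<j) =
  ℤP.∣i∣≡0⇒i≡0 (ℕP.n<1⇒n≡0 (ℕP.*-cancelʳ-< j ∣ i ∣ 1 (begin-strict
    ∣ i ∣ ℕ.* j  ≡⟨ ℤP.abs-* i (+ j) ⟨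
    ∣ i * + j ∣  <⟨ ∣ij∣<j ⟩
    j            ≡⟨ ℕP.*-identityˡ j ⟨
    1 ℕ.* j      ∎)))
  where open ℕP.≤-Reasoning

module QuadraticPacking (A l N k : ℕ) (α F : ℤ) where

  m n 2N c : ℤ
  m  = + A * + l + 1ℤ
  n  = + N * + l
  2N = + 2 * + N
  c  = + l * + k + α

  t z : ℤ → ℤ → ℤ
  t x y = + N * x - + A * y
  z x y = n * x - m * y

  Q : ℤ → ℤ → ℤ
  Q τ y = + l * (τ * τ) + α * τ + + 2 * + k * y + 2N * F

  V : ℤ → ℤ → ℤ
  V x y = Q (t x y) y

  Cone : ℤ → ℤ → Set
  Cone x y = 0ℤ ≤ y × 0ℤ ≤ z x y

  0≤2N : 0ℤ ≤ 2N
  0≤2N = *-nonNeg (0≤+ 2) (0≤+ N)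

  0≤2Nk : 0ℤ ≤ 2N * + k
  0≤2Nk = *-nonNeg 0≤2N (0≤+ k)

  τ₀ : ℤ
  τ₀ = 1ℤ + + ∣ α ∣ + 2N * + k

  0≤τ₀ : 0ℤ ≤ τ₀
  0≤τ₀ = ℤP.+-mono-≤ (0≤+ (suc ∣ α ∣)) 0≤2Nk

  z≡l*t-y : ∀ x y → z x y ≡ + l * t x y - y
  z≡l*t-y x y = identity (+ A) (+ l) (+ N) x y
    where
    identity : ∀ A l N x y → N * l * x - (A * l + 1ℤ) * y ≡ l * (N * x - A * y) - y
    identity = solve-∀

  t-shift : ∀ x y → t (x + + A) (y + + N) ≡ t x y
  t-shift x y = identity (+ A) (+ N) x y
    where
    identity : ∀ A N x y → N * (x + A) - A * (y + N) ≡ N * x - A * y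
    identity = solve-∀

  z-shift : ∀ x y → z (x + + A) (y + + N) ≡ z x y - + N
  z-shift x y = identity (+ A) (+ l) (+ N) x y
    where
    identity : ∀ A l N x y →
      N * l * (x + A) - (A * l + 1ℤ) * (y + N) ≡ N * l * x - (A * l + 1ℤ) * y - N
    identity = solve-∀

  V-shift : ∀ x y → V (x + + A) (y + + N) ≡ V x y + 2N * + k
  V-shift x y = begin
    Q (t (x + + A) (y + + N)) (y + + N)  ≡⟨ cong (λ τ → Q τ (y + + N)) (t-shift x y) ⟩
    Q (t x y) (y + + N)                  ≡⟨ identity (+ l * (τ * τ) + α * τ) (+ k) (+ N) y F ⟩
    Q (t x y) y + 2N * + k               ∎
    where
    open ≡-Reasoning
    τ : ℤ
    τ = t x y
    identity : ∀ a k N y F → a + + 2 * k * (y + N) + + 2 * N * F ≡ a + + 2 * k * y + + 2 * N * F + + 2 * N * k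
    identity = solve-∀

  Q-factorisation : ∀ τ T y y′ → Q τ y + 2N * + k ≡ Q T y′ →
    (τ - (T - + k)) * (+ l * (τ + (T - + k)) + α + + 2 * + k * + l)
      ≡ + k * (c + + 2 * (+ l * τ - y + y′ - + N))
  Q-factorisation τ T y y′ eq = begin
    (τ - (T - + k)) * (+ l * (τ + (T - + k)) + α + + 2 * + k * + l)
      ≡⟨ identity (+ l) α (+ k) (+ N) F τ T y y′ ⟩
    δ + (Q τ y + 2N * + k - Q T y′)  ≡⟨ cong (_+_ δ) (ℤP.i≡j⇒i-j≡0 eq) ⟩
    δ + 0ℤ                           ≡⟨ ℤP.+-identityʳ δ ⟩
    δ                                ∎
    where
    open ≡-Reasoning
    δ : ℤ
    δ = + k * (c + + 2 * (+ l * τ - y + y′ - + N))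
    identity : ∀ l α k N F τ T y y′ →
      (τ - (T - k)) * (l * (τ + (T - k)) + α + + 2 * k * l)
      ≡ k * (l * k + α + + 2 * (l * τ - y + y′ - N))
        + ((l * (τ * τ) + α * τ + + 2 * k * y + + 2 * N * F) + + 2 * N * k
           - (l * (T * T) + α * T + + 2 * k * y′ + + 2 * N * F))
    identity = solve-∀

  module Positive (0<l : 0 ℕ.< l) (0<N : 0 ℕ.< N) where

    0≤l-1 : 0ℤ ≤ + l - 1ℤ
    0≤l-1 = ℤP.i≤j⇒0≤j-i (+≤+ 0<l)

    0≤N-1 : 0ℤ ≤ + N - 1ℤ
    0≤N-1 = ℤP.i≤j⇒0≤j-i (+≤+ 0<N)

    0<2N : 0ℤ < 2N
    0<2N = subst (0ℤ <_) (ℤP.pos-* 2 N) (+<+ (ℕP.*-monoʳ-< 2 0<N))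

    N-1<N : N ∸ 1 ℕ.< N
    N-1<N = ℕP.∸-monoʳ-< (s≤s z≤n) 0<N

    far : ℤ → ℤ
    far B = + A + B + + N

    far∈Cone : ∀ {B} y′ → 0ℤ ≤ B → y′ ℕ.≤ N → Cone (far B) (+ y′)
    far∈Cone {B} y′ 0≤B y′≤N = 0≤+ y′ , subst (0ℤ ≤_) (sym (identity (+ A) (+ l) (+ N) B (+ y′)))
      (ℤP.+-mono-≤ (ℤP.+-mono-≤ (ℤP.+-mono-≤
        (*-nonNeg (*-nonNeg (0≤+ A) (0≤+ l)) 0≤N-y′)
        (*-nonNeg (*-nonNeg (0≤+ N) (0≤+ l)) 0≤B))
        (*-nonNeg (0≤+ N) (ℤP.+-mono-≤ (*-nonNeg 0≤N-1 (0≤+ l)) 0≤l-1)))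
        0≤N-y′)
      where
      0≤N-y′ : 0ℤ ≤ + N - + y′
      0≤N-y′ = ℤP.i≤j⇒0≤j-i (+≤+ y′≤N)
      identity : ∀ A l N B y → N * l * (A + B + N) - (A * l + 1ℤ) * y
        ≡ A * l * (N - y) + N * l * B + N * ((N - 1ℤ) * l + (l - 1ℤ)) + (N - y)
      identity = solve-∀

    B≤t-far : ∀ {B} y′ → 0ℤ ≤ B → y′ ℕ.≤ N → B ≤ t (far B) (+ y′)
    B≤t-far {B} y′ 0≤B y′≤N = ≤-by-gap _
      (ℤP.+-mono-≤ (ℤP.+-mono-≤
        (*-nonNeg (0≤+ A) (ℤP.i≤j⇒0≤j-i (+≤+ y′≤N)))
        (*-nonNeg 0≤N-1 0≤B))
        (*-nonNeg (0≤+ N) (0≤+ N)))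
      (identity (+ A) (+ N) B (+ y′))
      where
      identity : ∀ A N B y → N * (A + B + N) - A * y ≡ B + (A * (N - y) + (N - 1ℤ) * B + N * N)
      identity = solve-∀

    Q-large : ∀ {τ y} → 0ℤ ≤ F → 0ℤ ≤ y → τ₀ ≤ τ → 2N * + k ≤ Q τ y
    Q-large {τ} {y} 0≤F 0≤y τ₀≤τ = ≤-by-gap _
      (ℤP.+-mono-≤ (ℤP.+-mono-≤ (ℤP.+-mono-≤ (ℤP.+-mono-≤ (ℤP.+-mono-≤
        (*-nonNeg 0≤l-1 (*-nonNeg 0≤τ 0≤τ))
        (*-nonNeg 0≤τ (ℤP.+-mono-≤ 0≤τ-τ₀ (0≤i+∣i∣ α))))
        (*-nonNeg (ℤP.+-mono-≤ (ℤP.+-mono-≤ 0≤τ-τ₀ (0≤+ ∣ α ∣)) 0≤2Nk) 0≤2Nk))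
        0≤τ)
        (*-nonNeg (*-nonNeg (0≤+ 2) (0≤+ k)) 0≤y))
        (*-nonNeg 0≤2N 0≤F))
      (identity (+ l) α (+ ∣ α ∣) (+ k) (+ N) F τ y)
      where
      0≤τ-τ₀ : 0ℤ ≤ τ - τ₀
      0≤τ-τ₀ = ℤP.i≤j⇒0≤j-i τ₀≤τ
      0≤τ : 0ℤ ≤ τ
      0≤τ = ℤP.≤-trans 0≤τ₀ τ₀≤τ
      identity : ∀ l α a k N F τ y →
        l * (τ * τ) + α * τ + + 2 * k * y + + 2 * N * F
        ≡ + 2 * N * k + ((l - 1ℤ) * (τ * τ) + τ * ((τ - (1ℤ + a + + 2 * N * k)) + (α + a))
            + ((τ - (1ℤ + a + + 2 * N * k)) + a + + 2 * N * k) * (+ 2 * N * k)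
            + τ + + 2 * k * y + + 2 * N * F)
      identity = solve-∀

    record RowSolution (y′ : ℕ) : Set where
      field
        x y X    : ℤ
        z-nonNeg : 0ℤ ≤ z x y
        z<N      : z x y < + N
        t-drop   : t x y ≡ t X (+ y′) - + k
        slope    : c + + 2 * (z x y + + y′ - + N) ≡ 0ℤ

    module Packed (0<k : 0 ℕ.< k) (packing : IsScaledPacking Cone 2N V) where
      open IsScaledPacking packing

      F-nonNeg : 0ℤ ≤ F
      F-nonNeg = subst (0ℤ ≤_) (sym F≡v) (0≤+ (proj₁ (integral origin∈Cone)))
        where
        origin∈Cone : Cone 0ℤ 0ℤ
        origin∈Cone = ℤP.≤-refl , ℤP.≤-reflexive (sym (z-origin (+ A) (+ l) (+ N)))
          where
          z-origin : ∀ A l N → N * l * 0ℤ - (A * l + 1ℤ) * 0ℤ ≡ 0ℤ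
          z-origin = solve-∀
        V-origin : ∀ A l N k α F → l * ((N * 0ℤ - A * 0ℤ) * (N * 0ℤ - A * 0ℤ)) + α * (N * 0ℤ - A * 0ℤ)
                     + + 2 * k * 0ℤ + + 2 * N * F ≡ + 2 * N * F
        V-origin = solve-∀
        F≡v : F ≡ + proj₁ (integral origin∈Cone)
        F≡v = ℤP.*-cancelˡ-≡ 2N _ _ {{ℤ.>-nonZero 0<2N}}
          (trans (sym (V-origin (+ A) (+ l) (+ N) (+ k) α F)) (proj₂ (integral origin∈Cone)))

      module Row (y′ : ℕ) (y′<N : y′ ℕ.< N) where
        K : ℕ
        K = k ℕ.* (∣ c ∣ ℕ.+ 2 ℕ.* N)

        -- B makes T at least τ₀, as Q-large needs, and makes Fct exceed K ≥ ∣ δ ∣ (see 1+K≤Fct).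
        B X T : ℤ
        B = τ₀ + (+ K + + k)
        X = far B
        T = t X (+ y′)

        0≤B : 0ℤ ≤ B
        0≤B = ℤP.+-mono-≤ 0≤τ₀ (0≤+ (K ℕ.+ k))

        B≤T : B ≤ T
        B≤T = B≤t-far y′ 0≤B (ℕP.<⇒≤ y′<N)

        X∈Cone : Cone X (+ y′)
        X∈Cone = far∈Cone y′ 0≤B (ℕP.<⇒≤ y′<N)

        v : ℕ
        v = proj₁ (integral X∈Cone)

        VX≡2Nv : V X (+ y′) ≡ 2N * + v
        VX≡2Nv = proj₂ (integral X∈Cone)

        k≤v : k ℕ.≤ v
        k≤v = ℤP.drop‿+≤+ (ℤP.*-cancelˡ-≤-pos (+ k) (+ v) 2N {{ℤ.positive 0<2N}}
          (subst (2N * + k ≤_) VX≡2Nv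
            (Q-large F-nonNeg (0≤+ y′) (ℤP.≤-trans (ℤP.i≤i+j τ₀ (+ K + + k)) B≤T))))

        preimage : ∃[ x ] ∃[ y ] Cone x y × V x y ≡ 2N * + (v ∸ k)
        preimage = surjective (v ∸ k)

        x y : ℤ
        x = proj₁ preimage
        y = proj₁ (proj₂ preimage)

        x∈Cone : Cone x y
        x∈Cone = proj₁ (proj₂ (proj₂ preimage))

        V-step : V x y + 2N * + k ≡ V X (+ y′)
        V-step = begin
          V x y + 2N * + k               ≡⟨ cong (_+ 2N * + k) (proj₂ (proj₂ (proj₂ preimage))) ⟩
          2N * + (v ∸ k) + 2N * + k      ≡⟨ ℤP.*-distribˡ-+ 2N (+ (v ∸ k)) (+ k) ⟨
          2N * (+ (v ∸ k) + + k)         ≡⟨ cong (2N *_) (ℤP.pos-+ (v ∸ k) k) ⟩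
          2N * + (v ∸ k ℕ.+ k)           ≡⟨ cong (λ a → 2N * + a) (ℕP.m∸n+n≡m k≤v) ⟩
          2N * + v                       ≡⟨ VX≡2Nv ⟨
          V X (+ y′)                     ∎
          where open ≡-Reasoning

        shift∉Cone : ¬ Cone (x + + A) (y + + N)
        shift∉Cone ∈Cone = ℤP.<-irrefl (sym (proj₂ same)) (ℤP.<-≤-trans (+<+ y′<N) N≤y+N)
          where
          same : x + + A ≡ X × y + + N ≡ + y′
          same = injective ∈Cone X∈Cone (trans (V-shift x y) V-step)
          N≤y+N : + N ≤ y + + N
          N≤y+N = ℤP.+-monoˡ-≤ (+ N) (proj₁ x∈Cone)

        z<N : z x y < + N
        z<N = ℤP.≰⇒> λ N≤z → shift∉Cone (ℤP.+-mono-≤ (proj₁ x∈Cone) (0≤+ N) ,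
          subst (0ℤ ≤_) (sym (z-shift x y)) (ℤP.i≤j⇒0≤j-i N≤z))

        t-nonNeg : 0ℤ ≤ t x y
        t-nonNeg = ℤP.*-cancelˡ-≤-pos 0ℤ (t x y) (+ l) {{ℤ.positive (+<+ 0<l)}}
          (subst₂ _≤_ (sym (ℤP.*-zeroʳ (+ l))) l*t≡y+z (ℤP.+-mono-≤ (proj₁ x∈Cone) (proj₂ x∈Cone)))
          where
          l*t≡y+z : y + z x y ≡ + l * t x y
          l*t≡y+z = trans (cong (_+_ y) (z≡l*t-y x y)) (identity y (+ l * t x y))
            where
            identity : ∀ y a → y + (a - y) ≡ a
            identity = solve-∀

        s w Fct δ : ℤ
        s   = T - + k
        w   = z x y + + y′ - + N
        Fct = + l * (t x y + s) + α + + 2 * + k * + l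
        δ   = + k * (c + + 2 * w)

        factorisation : (t x y - s) * Fct ≡ δ
        factorisation = trans (Q-factorisation (t x y) T y (+ y′) V-step)
          (cong (λ ζ → + k * (c + + 2 * (ζ + + y′ - + N))) (sym (z≡l*t-y x y)))

        ∣w∣≤N : ∣ w ∣ ℕ.≤ N
        ∣w∣≤N = ∣i∣≤n
          (≤-by-gap _ (ℤP.+-mono-≤ (proj₂ x∈Cone) (0≤+ y′)) (identityˡ (z x y) (+ y′) (+ N)))
          (≤-by-gap _ (ℤP.+-mono-≤ (ℤP.i≤j⇒0≤j-i (ℤP.<⇒≤ z<N)) (ℤP.i≤j⇒0≤j-i (+≤+ (ℕP.<⇒≤ y′<N))))
            (identityʳ (z x y) (+ y′) (+ N)))
          where
          identityˡ : ∀ z y N → z + y - N ≡ - N + (z + y)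
          identityˡ = solve-∀
          identityʳ : ∀ z y N → N ≡ z + y - N + ((N - z) + (N - y))
          identityʳ = solve-∀

        ∣δ∣≤K : ∣ δ ∣ ℕ.≤ K
        ∣δ∣≤K = begin
          ∣ δ ∣                          ≡⟨ ℤP.abs-* (+ k) (c + + 2 * w) ⟩
          k ℕ.* ∣ c + + 2 * w ∣          ≤⟨ ℕP.*-monoʳ-≤ k (ℤP.∣i+j∣≤∣i∣+∣j∣ c (+ 2 * w)) ⟩
          k ℕ.* (∣ c ∣ ℕ.+ ∣ + 2 * w ∣)  ≡⟨ cong (λ a → k ℕ.* (∣ c ∣ ℕ.+ a)) (ℤP.abs-* (+ 2) w) ⟩
          k ℕ.* (∣ c ∣ ℕ.+ 2 ℕ.* ∣ w ∣)  ≤⟨ ℕP.*-monoʳ-≤ k (ℕP.+-monoʳ-≤ ∣ c ∣ (ℕP.*-monoʳ-≤ 2 ∣w∣≤N)) ⟩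
          K                              ∎
          where open ℕP.≤-Reasoning

        0≤s : 0ℤ ≤ s
        0≤s = ℤP.i≤j⇒0≤j-i (ℤP.≤-trans (ℤP.i≤j+i (+ k) (+ K)) (ℤP.≤-trans (ℤP.+-monoˡ-≤ (+ K + + k) 0≤τ₀) B≤T))

        1+K≤Fct : 1ℤ + + K ≤ Fct
        1+K≤Fct = ≤-by-gap _
          (ℤP.+-mono-≤ (ℤP.+-mono-≤ (ℤP.+-mono-≤ (ℤP.+-mono-≤ (ℤP.+-mono-≤
            (*-nonNeg 0≤l-1 (ℤP.+-mono-≤ t-nonNeg 0≤s))
            t-nonNeg)
            (ℤP.i≤j⇒0≤j-i B≤T))
            (0≤i+∣i∣ α))
            0≤2Nk)
            (*-nonNeg (*-nonNeg (0≤+ 2) (0≤+ k)) (0≤+ l)))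
          (identity (+ l) (t x y) T (+ k) α (+ ∣ α ∣) (+ K) (+ N))
          where
          identity : ∀ l t T k α a K N →
            l * (t + (T - k)) + α + + 2 * k * l
            ≡ 1ℤ + K + ((l - 1ℤ) * (t + (T - k)) + t + (T - ((1ℤ + a + + 2 * N * k) + (K + k)))
                         + (α + a) + + 2 * N * k + + 2 * k * l)
          identity = solve-∀

        ∣δ∣<Fct : + ∣ δ ∣ < Fct
        ∣δ∣<Fct = ℤP.suc[i]≤j⇒i<j (ℤP.≤-trans (ℤP.+-monoʳ-≤ 1ℤ (+≤+ ∣δ∣≤K)) 1+K≤Fct)

        t≡s : t x y ≡ s
        t≡s = ℤP.i-j≡0⇒i≡j (t x y) s (i*j≡k∧∣k∣<j⇒i≡0 (t x y - s) Fct δ factorisation ∣δ∣<Fct)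

        slope : c + + 2 * w ≡ 0ℤ
        slope = ℤP.*-cancelˡ-≡ (+ k) _ 0ℤ {{ℕ.>-nonZero 0<k}} (begin
          δ                   ≡⟨ factorisation ⟨
          (t x y - s) * Fct   ≡⟨ cong (_* Fct) (ℤP.i≡j⇒i-j≡0 t≡s) ⟩
          0ℤ * Fct            ≡⟨ ℤP.*-zeroˡ Fct ⟩
          0ℤ                  ≡⟨ ℤP.*-zeroʳ (+ k) ⟨
          + k * 0ℤ            ∎)
          where open ≡-Reasoning

        solution : RowSolution y′
        solution = record
          { x = x ; y = y ; X = X ; z-nonNeg = proj₂ x∈Cone ; z<N = z<N ; t-drop = t≡s ; slope = slope }

      c≡2 : c ≡ + 2
      c≡2 = ℤP.≤-antisym c≤2 2≤c
        where
        module R₀ = RowSolution (Row.solution 0 0<N)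
        module R₁ = RowSolution (Row.solution (N ∸ 1) N-1<N)
        2≤c : + 2 ≤ c
        2≤c = ≤-by-gap-and-zero _ _
          (*-nonNeg (0≤+ 2) (ℤP.i≤j⇒0≤j-i (ℤP.i<j⇒suc[i]≤j R₀.z<N))) R₀.slope
          (identity c (z R₀.x R₀.y) (+ N))
          where
          identity : ∀ c z N → c ≡ + 2 + + 2 * (N - (1ℤ + z)) + (c + + 2 * (z + + 0 - N))
          identity = solve-∀
        c≤2 : c ≤ + 2
        c≤2 = ≤-by-gap-and-zero _ _ (*-nonNeg (0≤+ 2) R₁.z-nonNeg) (cong -_ R₁.slope)
          (subst (λ N-1 → + 2 ≡ c + + 2 * z₁ + - (c + + 2 * (z₁ + N-1 - + N))) (ℤP.⊖-≥ 0<N)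
            (identity c z₁ (+ N)))
          where
          z₁ : ℤ
          z₁ = z R₁.x R₁.y
          identity : ∀ c z N → + 2 ≡ c + + 2 * z + - (c + + 2 * (z + (N - 1ℤ) - N))
          identity = solve-∀

      row-divides : ∀ {y′} → RowSolution y′ → + N ∣ + k - + A + + l * + A * (+ A * + y′ + + k)
      row-divides {y′} row = divides q (begin
        + k - + A + + l * + A * (+ A * + y′ + + k)
          ≡⟨ identity (+ k) (+ A) (+ l) (+ N) (+ y′) x y X ⟩
        q * + N + m * (t x y - (t X (+ y′) - + k)) - + A * (w + 1ℤ)
          ≡⟨ cong₂ (λ a b → q * + N + m * a - + A * b) (ℤP.i≡j⇒i-j≡0 t-drop) w+1≡0 ⟩
        q * + N + m * 0ℤ - + A * 0ℤ
          ≡⟨ identity₀ (q * + N) m (+ A) ⟩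
        q * + N ∎)
        where
        open ≡-Reasoning
        open RowSolution row
        q w : ℤ
        q = + A * + l * X - x + X - + A
        w = z x y + + y′ - + N
        w+1≡0 : w + 1ℤ ≡ 0ℤ
        w+1≡0 = ℤP.*-cancelˡ-≡ (+ 2) _ 0ℤ (begin
          + 2 * (w + 1ℤ)    ≡⟨ ℤP.*-distribˡ-+ (+ 2) w 1ℤ ⟩
          + 2 * w + + 2     ≡⟨ ℤP.+-comm (+ 2 * w) (+ 2) ⟩
          + 2 + + 2 * w     ≡⟨ cong (_+ + 2 * w) c≡2 ⟨
          c + + 2 * w       ≡⟨ slope ⟩
          0ℤ                ∎)
        identity : ∀ k A l N y′ x y X →
          k - A + l * A * (A * y′ + k)
          ≡ (A * l * X - x + X - A) * N + (A * l + 1ℤ) * (N * x - A * y - (N * X - A * y′ - k))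
            - A * (N * l * x - (A * l + 1ℤ) * y + y′ - N + 1ℤ)
        identity = solve-∀
        identity₀ : ∀ a m A → a + m * 0ℤ - A * 0ℤ ≡ a
        identity₀ = solve-∀

      -- With u y′ the quantity of row-divides: u 0 − u (N − 1) ≡ l A² (mod N), and
      -- u 0 (1 − l A) + (l k − 1) l A² = k − A.
      N∣k-A : + N ∣ + k - + A
      N∣k-A = subst (+ N ∣_) (sym (identity (+ k) (+ A) (+ l) (+ N)))
        (∣m∣n⇒∣m+n (∣m⇒∣m*n (1ℤ - + l * + A) N∣u₀) (∣n⇒∣m*n (+ l * + k - 1ℤ)
          (∣m∣n⇒∣m-n (∣n⇒∣m*n (+ l * + A * + A) (∣-refl {+ N})) (∣m∣n⇒∣m-n N∣u₁ N∣u₀))))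
        where
        N∣u₀ : + N ∣ + k - + A + + l * + A * (+ A * + 0 + + k)
        N∣u₀ = row-divides (Row.solution 0 0<N)
        N∣u₁ : + N ∣ + k - + A + + l * + A * (+ A * (+ N - 1ℤ) + + k)
        N∣u₁ = subst (λ N-1 → + N ∣ + k - + A + + l * + A * (+ A * N-1 + + k)) (sym (ℤP.⊖-≥ 0<N))
          (row-divides (Row.solution (N ∸ 1) N-1<N))
        identity : ∀ k A l N →
          k - A ≡ (k - A + l * A * (A * + 0 + k)) * (1ℤ - l * A)
                  + (l * k - 1ℤ) * (l * A * A * N
                                    - ((k - A + l * A * (A * (N - 1ℤ) + k)) - (k - A + l * A * (A * + 0 + k))))
        identity = solve-∀

      N∣A[N-1]+k : + N ∣ + A * + (N ∸ 1) - - + k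
      N∣A[N-1]+k = subst (+ N ∣_)
        (trans (identity (+ k) (+ A) (+ N)) (cong (λ N-1 → + A * N-1 - - + k) (ℤP.⊖-≥ 0<N)))
        (∣m∣n⇒∣m+n N∣k-A (∣n⇒∣m*n (+ A) (∣-refl {+ N})))
        where
        identity : ∀ k A N → k - A + A * N ≡ A * (N - 1ℤ) - - k
        identity = solve-∀

module Reduction (m n : ℕ) .{{_ : NonZero m}} .{{_ : NonZero n}} (D E F : ℤ) (k : ℕ) where

  l A N : ℕ
  l = lg m n
  A = a/l m n
  N = n/l m n

  instance
    l≢0 : NonZero l
    l≢0 = lg≢0 m n

  m-1≡A*l : m ∸ 1 ≡ A ℕ.* l
  m-1≡A*l = sym (m/n*n≡m (gcd[m,n]∣m (m ∸ 1) n))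

  n≡N*l : n ≡ N ℕ.* l
  n≡N*l = sym (m/n*n≡m (gcd[m,n]∣n (m ∸ 1) n))

  0<l : 0 ℕ.< l
  0<l = ℕ.>-nonZero⁻¹ l

  0<N : 0 ℕ.< N
  0<N = ℕP.n≢0⇒n>0 λ N≡0 → ℕ.≢-nonZero⁻¹ n (trans n≡N*l (cong (ℕ._* l) N≡0))

  α : ℤ
  α = D + D - + n

  module QP = QuadraticPacking A l N k α F
  open QP.Positive 0<l 0<N public using (0<2N; N-1<N; module Packed)

  QP-m≡m : QP.m ≡ + m
  QP-m≡m = begin
    + A * + l + 1ℤ      ≡⟨ ℤP.+-comm (+ A * + l) 1ℤ ⟩
    1ℤ + + A * + l      ≡⟨ cong (_+_ 1ℤ) (ℤP.pos-* A l) ⟨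
    + (1 ℕ.+ A ℕ.* l)   ≡⟨ cong (λ a → + (1 ℕ.+ a)) m-1≡A*l ⟨
    + (1 ℕ.+ (m ∸ 1))   ≡⟨ cong +_ (ℕP.m+[n∸m]≡n (ℕ.>-nonZero⁻¹ m)) ⟩
    + m                 ∎
    where open ≡-Reasoning

  QP-n≡n : QP.n ≡ + n
  QP-n≡n = trans (sym (ℤP.pos-* N l)) (cong +_ (sym n≡N*l))

  I⇒Cone : ∀ {x y} → I (+ n / m) x y → QP.Cone x y
  I⇒Cone {x} {y} (0≤y , y≤nx/m) = 0≤y , ℤP.i≤j⇒0≤j-i
    (subst₂ (λ a b → a * y ≤ b * x) (sym QP-m≡m) (sym QP-n≡n)
      (Equivalence.to (toℚ-≤-/-⇔ m n x y) y≤nx/m))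

  Cone⇒I : ∀ {x y} → QP.Cone x y → I (+ n / m) x y
  Cone⇒I {x} {y} (0≤y , 0≤z) = 0≤y ,
    Equivalence.from (toℚ-≤-/-⇔ m n x y)
      (subst₂ (λ a b → a * y ≤ b * x) QP-m≡m QP-n≡n (ℤP.0≤i-j⇒j≤i 0≤z))

  l′ N′ A′ k′ h : ℚ
  l′ = toℚ (+ l)
  N′ = toℚ (+ N)
  A′ = toℚ (+ A)
  k′ = toℚ (+ k)
  h  = + n / 2

  Qℚ : ℚ → ℚ → ℚ → ℚ
  Qℚ a τ η = l′ ℚ.* (τ ℚ.* τ) ℚ.+ a ℚ.* τ ℚ.+ (k′ ℚ.+ k′) ℚ.* η ℚ.+ (N′ ℚ.+ N′) ℚ.* toℚ F

  toℚ-Q : ∀ τ y → toℚ (QP.Q τ y) ≡ Qℚ (toℚ α) (toℚ τ) (toℚ y)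
  toℚ-Q τ y =
    trans (toℚ-+ (a + b + c) d) (cong₂ ℚ._+_
      (trans (toℚ-+ (a + b) c) (cong₂ ℚ._+_ (trans (toℚ-+ a b) (cong₂ ℚ._+_ a≡ (toℚ-* α τ))) c≡))
      d≡)
    where
    a b c d : ℤ
    a = + l * (τ * τ)
    b = α * τ
    c = + 2 * + k * y
    d = QP.2N * F
    a≡ : toℚ a ≡ l′ ℚ.* (toℚ τ ℚ.* toℚ τ)
    a≡ = trans (toℚ-* (+ l) (τ * τ)) (cong (l′ ℚ.*_) (toℚ-* τ τ))
    c≡ : toℚ c ≡ (k′ ℚ.+ k′) ℚ.* toℚ y
    c≡ = trans (toℚ-* (+ 2 * + k) y) (cong (ℚ._* toℚ y) (toℚ-2* (+ k)))
    d≡ : toℚ d ≡ (N′ ℚ.+ N′) ℚ.* toℚ F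
    d≡ = trans (toℚ-* QP.2N F) (cong (ℚ._* toℚ F) (toℚ-2* (+ N)))

  toℚ-t : ∀ x y → toℚ (QP.t x y) ≡ N′ ℚ.* toℚ x ℚ.- A′ ℚ.* toℚ y
  toℚ-t x y = trans (toℚ-- (+ N * x) (+ A * y)) (cong₂ ℚ._-_ (toℚ-* (+ N) x) (toℚ-* (+ A) y))

  toℚ-n : toℚ (+ n) ≡ l′ ℚ.* N′
  toℚ-n = trans (cong toℚ (trans (sym QP-n≡n) (ℤP.*-comm (+ N) (+ l)))) (toℚ-* (+ l) (+ N))

  toℚ-α : toℚ α ≡ toℚ D ℚ.+ toℚ D ℚ.- l′ ℚ.* N′
  toℚ-α = trans (toℚ-- (D + D) (+ n)) (cong₂ ℚ._-_ (toℚ-+ D D) toℚ-n)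

  h+h≡l′N′ : h ℚ.+ h ≡ l′ ℚ.* N′
  h+h≡l′N′ = trans (identity h) (trans (/-*-toℚ (+ n) 2 2 (+ n) refl) toℚ-n)
    where
    identity : ∀ q → q ℚ.+ q ≡ q ℚ.* toℚ (+ 2)
    identity = RingSolver.solve-∀ ℚ-ring

  [m-1]/n*N′≡A′ : (m-1 m / n) ℚ.* N′ ≡ A′
  [m-1]/n*N′≡A′ = /-*-toℚ (m-1 m) n N (+ A) (begin
    + (m ∸ 1) * + N       ≡⟨ ℤP.pos-* (m ∸ 1) N ⟨
    + ((m ∸ 1) ℕ.* N)     ≡⟨ cong (λ a → + (a ℕ.* N)) m-1≡A*l ⟩
    + (A ℕ.* l ℕ.* N)     ≡⟨ cong +_ (ℕP.*-assoc A l N) ⟩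
    + (A ℕ.* (l ℕ.* N))   ≡⟨ cong (λ a → + (A ℕ.* a)) (trans (ℕP.*-comm l N) (sym n≡N*l)) ⟩
    + (A ℕ.* n)           ≡⟨ ℤP.pos-* A n ⟩
    + A * + n             ∎)
    where open ≡-Reasoning

  2N*P≡V : kval m n D E ≡ k′ → ∀ x y → toℚ QP.2N ℚ.* Ppoly m n D E F x y ≡ toℚ (QP.V x y)
  2N*P≡V kval≡k x y = begin
    toℚ QP.2N ℚ.* Ppoly m n D E F x y    ≡⟨ cong (ℚ._* Ppoly m n D E F x y) (toℚ-2* (+ N)) ⟩
    (N′ ℚ.+ N′) ℚ.* Ppoly m n D E F x y  ≡⟨ P-expansion (toℚ x) (toℚ y) (toℚ D) (toℚ E) (toℚ F)
                                              N′ A′ l′ h (m-1 m / n) w k′ h+h≡l′N′ [m-1]/n*N′≡A′ K≡k′ ⟩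
    Qℚ (toℚ D ℚ.+ toℚ D ℚ.- l′ ℚ.* N′) (N′ ℚ.* toℚ x ℚ.- A′ ℚ.* toℚ y) (toℚ y)
                                          ≡⟨ cong₂ (λ a τ → Qℚ a τ (toℚ y)) toℚ-α (toℚ-t x y) ⟨
    Qℚ (toℚ α) (toℚ (QP.t x y)) (toℚ y)  ≡⟨ toℚ-Q (QP.t x y) y ⟨
    toℚ (QP.V x y)                        ∎
    where
    open ≡-Reasoning
    w : ℚ
    w = ℚ.½ ℚ.* ((m-1 m * m-1 m) / n)
    K≡k′ : (toℚ D ℚ.- h) ℚ.* A′ ℚ.+ (toℚ E ℚ.- w) ℚ.* N′ ≡ k′
    K≡k′ = trans (cong₂ (λ a b → (toℚ D ℚ.- h) ℚ.* a ℚ.+ (toℚ E ℚ.- w) ℚ.* b)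
      (sym (/-≡-toℚ (m-1 m) l (+ A) (trans (cong +_ m-1≡A*l) (ℤP.pos-* A l))))
      (sym (/-≡-toℚ (+ n) l (+ N) (sym QP-n≡n)))) kval≡k

lemma5 : (m n : ℕ) .{{_ : NonZero m}} .{{_ : NonZero n}} → Coprime m n →
         (D E F : ℤ) → IsPackingOn (I (+ n / m)) (Ppoly m n D E F) →
         (k : ℕ) → kval m n D E ≡ toℚ (+ k) → 0 ℕ.< k →
         IsY m n k (n/l m n ∸ 1)
lemma5 m n _ D E F packing k kval≡k 0<k = N-1<N , ∣⇒∣ᵤ (Packed.N∣A[N-1]+k 0<k scaledPacking)
  where
  open Reduction m n D E F k
  scaledPacking : IsScaledPacking QP.Cone QP.2N QP.V
  scaledPacking = IsPackingOn⇒IsScaledPacking QP.2N {{ℤ.>-nonZero 0<2N}}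
    I⇒Cone Cone⇒I (2N*P≡V kval≡k) packing
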